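{- Let $g=(G,A)$ be a graph game board with no unbroached components. Let $u,w\in A$ with $u\ne w$, $\mathrm{wt}(u)=a$, $\mathrm{wt}(w)=b$. Let $m=\max\{\mathrm{wt}(v): v \text{ a vertex of } G\}$ and $m'=\max\{\mathrm{wt}(v): v\text{ a vertex of } G,\ v\ne u\}$. Then (i) $\mathrm{val}(g)\le a-\mathrm{val}(g\backslash u)+2(m-a)$, and (ii) $b-\mathrm{val}(g\backslash w)\le a-\mathrm{val}(g\backslash u)+2(m'-a)$.
   Context: A graph game board is a pair $g=(G,A)$ where $G$ is a finite simple graph whose vertices carry real weights $\mathrm{wt}(v)$ and $A$ is a set of vertices (available). A component of $G$ is unbroached if it contains no vertex of $A$. $g\backslash v$: delete $v$ and its edges and replace $A$ by $(A\cup\{$neighbours of $v\})\backslash\{v\}$. Legal initial moves: vertices of $A$ and all vertices of unbroached components. Players alternately choose legal moves (Player One first) until no vertices remain; Player One's outcome is the weight he took minus the weight taken by Player Two; $\mathrm{val}(g)$ is this under optimal play (value of the empty board is $0$).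
   Formalization: The vertex weights $\mathrm{wt}(v)$ are rational numbers instead of real numbers, so the value val and the maxima m and m′ are taken over ℚ. -}

module Defs where

open import Data.Nat using (ℕ; zero; suc)
open import Data.Fin using (Fin; _≟_)
open import Data.Bool using (Bool; true; false; _∧_; _∨_; not; if_then_else_)
open import Data.List using (List; []; _∷_; foldr; concatMap; allFin)
open import Data.Bool.ListAction using (any)
open import Data.Rational using (ℚ; _-_; _⊔_; 0ℚ)
open import Relation.Nullary using (does)
open import Relation.Binary.PropositionalEquality using (_≡_; refl)

record Graph (n : ℕ) : Set where
  field
    adj     : Fin n → Fin n → Bool
    adj-sym : ∀ i j → adj i j ≡ adj j i
    adj-irr : ∀ i → adj i i ≡ false
    wt      : Fin n → ℚ
open Graph public

_==_ : ∀ {n} → Fin n → Fin n → Bool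
x == y = does (x ≟ y)

-- A board: the current vertex set V (the graph is the induced subgraph of G on V)
-- and the set A ⊆ V of available vertices.
record Board {n : ℕ} (G : Graph n) : Set where
  field
    V   : Fin n → Bool
    A   : Fin n → Bool
    A⊆V : ∀ i → A i ≡ true → V i ≡ true
open Board public


delV : ∀ {n} {G : Graph n} → Board G → Fin n → Fin n → Bool
delV b v x = V b x ∧ not (x == v)

delA : ∀ {n} {G : Graph n} → Board G → Fin n → Fin n → Bool
delA {G = G} b v x = (A b x ∨ (adj G v x ∧ V b x)) ∧ not (x == v)

boolLemma : ∀ (a c v e : Bool) → (a ≡ true → v ≡ true) →
            (a ∨ c ∧ v) ∧ not e ≡ true → v ∧ not e ≡ true
boolLemma true  c true  false h h' = refl
boolLemma true  c false false h h' with () ← h refl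
boolLemma false true true false h h' = refl

delA⊆ : ∀ {n} {G : Graph n} (b : Board G) (v x : Fin n) →
        delA b v x ≡ true → delV b v x ≡ true
delA⊆ {G = G} b v x = boolLemma (A b x) (adj G v x) (V b x) (x == v) (A⊆V b x)

_∖_ : ∀ {n} {G : Graph n} → Board G → Fin n → Board G
b ∖ v = record { V = delV b v ; A = delA b v ; A⊆V = delA⊆ b v }

-- reach k v x : x is joined to v by a path of length ≤ k inside the current
-- vertex set. With k = n this is "x lies in the connected component of v".
reach : ∀ {n} {G : Graph n} → Board G → ℕ → Fin n → Fin n → Bool
reach b zero    v x = V b v ∧ (x == v)
reach {n} {G} b (suc k) v x =
  reach b k v x ∨ (V b x ∧ any (λ y → reach b k v y ∧ adj G y x) (allFin n))

sameComponent : ∀ {n} {G : Graph n} → Board G → Fin n → Fin n → Bool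
sameComponent {n} b v x = reach b n v x

inUnbroached : ∀ {n} {G : Graph n} → Board G → Fin n → Bool
inUnbroached {n} b v =
  V b v ∧ not (any (λ x → sameComponent b v x ∧ A b x) (allFin n))

NoUnbroached : ∀ {n} {G : Graph n} → Board G → Set
NoUnbroached {n} b = ∀ (v : Fin n) → inUnbroached b v ≡ false

legal : ∀ {n} {G : Graph n} → Board G → Fin n → Bool
legal b v = A b v ∨ inUnbroached b v

maxList : List ℚ → ℚ
maxList []       = 0ℚ
maxList (x ∷ xs) = foldr _⊔_ x xs

valF : ∀ {n} {G : Graph n} → ℕ → Board G → ℚ
valF zero    b = 0ℚ
valF {n} {G} (suc k) b =
  maxList (concatMap (λ v → if legal b v then (wt G v - valF k (b ∖ v)) ∷ [] else [])
                     (allFin n))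

-- Every move deletes a vertex, so n moves exhaust any board on Fin n.
val : ∀ {n} {G : Graph n} → Board G → ℚ
val {n} b = valF n b

maxWt : ∀ {n} {G : Graph n} → Board G → ℚ
maxWt {n} {G} b =
  maxList (concatMap (λ v → if V b v then wt G v ∷ [] else []) (allFin n))

maxWtExcept : ∀ {n} {G : Graph n} → Board G → Fin n → ℚ
maxWtExcept {n} {G} b u =
  maxList (concatMap (λ v → if V b v ∧ not (v == u) then wt G v ∷ [] else []) (allFin n))

{-# OPTIONS --safe #-}
module Submission where

open import Defs
open import Data.Nat using (ℕ)
open import Data.Fin using (Fin)
open import Data.Bool using (true)
open import Data.Integer using (+_)
open import Data.Rational using (ℚ; _+_; _-_; _*_; _/_; _≤_)
open import Data.Product using (_×_)
open import Relation.Binary.PropositionalEquality using (_≡_; _≢_)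

open import Data.Bool using (Bool; false; _∧_; _∨_; not; if_then_else_)
open import Data.Bool.Properties using (∧-conicalˡ; ∧-conicalʳ; ∧-identityʳ; ∨-identityʳ; ∨-zeroʳ; T-≡)
open import Data.Bool.Solver using (module ∨-∧-Solver)
open import Data.Empty using (⊥-elim)
open import Data.Fin using (zero; suc; _≟_)
open import Data.Bool.ListAction using (any; or)
open import Data.List using (List; []; _∷_; concatMap; allFin)
open import Data.List.Membership.Propositional using (_∈_)
open import Data.List.Membership.Propositional.Properties using (∈-allFin; ∈-concatMap⁺; ∈-concatMap⁻)
open import Data.List.Properties using (foldr-preservesᵇ; foldr-preservesᵒ; concatMap-cong; map-cong)
open import Data.List.Relation.Unary.All using (tabulate)
open import Data.List.Relation.Unary.Any using (here; there; satisfied; toSum)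
import Data.List.Relation.Unary.Any as Any
open import Data.List.Relation.Unary.Any.Properties using (any⁺; any⁻)
open import Data.Nat using (zero; suc; z≤n; s≤s) renaming (_+_ to _+ℕ_; _≤_ to _≤ℕ_)
open import Data.Nat.Properties using (≤-pred; m≤n⇒m≤1+n)
open import Data.Product using (∃-syntax; _,_; map₁; map₂)
open import Data.Rational using (0ℚ; -_)
open import Data.Rational.Properties
  using (≤-reflexive; +-mono-≤; +-monoˡ-≤; +-monoʳ-≤; ⊔-lub; p≤q⇒p≤q⊔r; p≤q⇒p≤r⊔q; module ≤-Reasoning)
open import Data.Rational.Solver using (module +-*-Solver)
open import Data.Sum using (_⊎_; inj₁; inj₂; [_,_]′)
import Data.Sum as Sum
open import Function using (_∘_; case_of_; Equivalence)
open import Relation.Binary.PropositionalEquality using (refl; sym; trans; cong; cong₂; subst; _≗_)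
open import Relation.Nullary using (yes; no)
open import Relation.Nullary.Decidable using (dec-true; dec-false)

-- Write ρ(g, v) = wt v − val (g ∖ v) for the value of opening with v. If M bounds the weights and u
-- is available, then every opening satisfies ρ(g, v) ≤ ρ(g, u) + 2 (M − wt u). In a board without
-- unbroached components the legal moves are exactly the available vertices, and this survives
-- deleting a vertex. For v ≠ u the opponent may answer v by u, still available in g ∖ v, so
-- ρ(g, v) ≤ wt v − wt u + val (g ∖ u ∖ v); by induction applied to g ∖ u and its opening v,
-- val (g ∖ u) ≤ wt v − val (g ∖ u ∖ v) + 2 (M − wt v), and adding the two gives the bound. Taking
-- the maximum over v gives (i). Only the weights of g ∖ u enter the case v ≠ u, which gives (ii).

∨-true⁻ : ∀ {x y} → x ∨ y ≡ true → x ≡ true ⊎ y ≡ true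
∨-true⁻ {true}  _ = inj₁ refl
∨-true⁻ {false} e = inj₂ e

∨-trueˡ : ∀ {x} y → x ≡ true → x ∨ y ≡ true
∨-trueˡ y refl = refl

∨-trueʳ : ∀ x {y} → y ≡ true → x ∨ y ≡ true
∨-trueʳ x refl = ∨-zeroʳ x

∧-true⁺ : ∀ {x y} → x ≡ true → y ≡ true → x ∧ y ≡ true
∧-true⁺ refl refl = refl

∧-not≡false : ∀ {x y} → (x ≡ true → y ≡ true) → x ∧ not y ≡ false
∧-not≡false {false} _ = refl
∧-not≡false {true}  h rewrite h refl = refl

∧-not≡false⁻ : ∀ {x y} → x ≡ true → x ∧ not y ≡ false → y ≡ true
∧-not≡false⁻ {y = true}  _    _  = refl
∧-not≡false⁻ {y = false} refl ()

module _ {A : Set} (p : A → Bool) where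

  any-witness : ∀ xs → any p xs ≡ true → ∃[ x ] p x ≡ true
  any-witness xs = map₂ (Equivalence.to T-≡) ∘ satisfied ∘ any⁻ p xs ∘ Equivalence.from T-≡

  any-true : ∀ {x xs} → x ∈ xs → p x ≡ true → any p xs ≡ true
  any-true x∈xs px = Equivalence.to T-≡ (any⁺ p (Any.map (λ { refl → Equivalence.from T-≡ px }) x∈xs))

module _ {n : ℕ} {x y : Fin n} where

  ==⇒≡ : (x == y) ≡ true → x ≡ y
  ==⇒≡ e with x ≟ y
  ... | yes x≡y = x≡y

  ≢⇒not== : x ≢ y → not (x == y) ≡ true
  ≢⇒not== x≢y = cong not (dec-false (x ≟ y) x≢y)

  not==⇒≢ : not (x == y) ≡ true → x ≢ y
  not==⇒≢ e x≡y with () ← trans (sym e) (cong not (dec-true (x ≟ y) x≡y))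

==-refl : ∀ {n} {x : Fin n} → (x == x) ≡ true
==-refl {x = x} = dec-true (x ≟ x) refl

maxList-ub : ∀ {y} ys → y ∈ ys → y ≤ maxList ys
maxList-ub (x ∷ xs) y∈ =
  foldr-preservesᵒ (λ p q → [ p≤q⇒p≤q⊔r q , p≤q⇒p≤r⊔q p ]′) x xs
    (Sum.map ≤-reflexive (Any.map ≤-reflexive) (toSum y∈))

maxList-lub : ∀ {y B} ys → y ∈ ys → (∀ {z} → z ∈ ys → z ≤ B) → maxList ys ≤ B
maxList-lub (x ∷ xs) _ ≤B = foldr-preservesᵇ ⊔-lub (≤B (here refl)) (tabulate (≤B ∘ there))

-- valF (suc k) b, maxWt b and maxWtExcept b u all unfold to instances of maxOver.
maxOver : {A : Set} → (A → Bool) → (A → ℚ) → List A → ℚ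
maxOver P f xs = maxList (concatMap (λ x → if P x then f x ∷ [] else []) xs)

module _ {A : Set} (P : A → Bool) (f : A → ℚ) where

  private
    select : A → List ℚ
    select x = if P x then f x ∷ [] else []

    ∈-select : ∀ {x} → P x ≡ true → f x ∈ select x
    ∈-select px rewrite px = here refl

    select-∈ : ∀ {x y} → y ∈ select x → P x ≡ true × y ≡ f x
    select-∈ {x} y∈ with P x
    ... | true with here y≡fx ← y∈ = refl , y≡fx

    ∈-selection : ∀ {x xs} → x ∈ xs → P x ≡ true → f x ∈ concatMap select xs
    ∈-selection x∈xs px = ∈-concatMap⁺ select (Any.map (λ { refl → ∈-select px }) x∈xs)

  maxOver-ub : ∀ {x xs} → x ∈ xs → P x ≡ true → f x ≤ maxOver P f xs
  maxOver-ub x∈xs px = maxList-ub _ (∈-selection x∈xs px)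

  maxOver-lub : ∀ {x xs B} → x ∈ xs → P x ≡ true → (∀ y → P y ≡ true → f y ≤ B) → maxOver P f xs ≤ B
  maxOver-lub {xs = xs} {B} x∈xs px ≤B = maxList-lub _ (∈-selection x∈xs px) bounded
    where
    bounded : ∀ {z} → z ∈ concatMap select xs → z ≤ B
    bounded z∈ with satisfied (∈-concatMap⁻ select {xs = xs} z∈)
    ... | y , z∈y with select-∈ z∈y
    ...   | py , refl = ≤B y py

  maxOver-none : ∀ xs → (∀ x → P x ≢ true) → maxOver P f xs ≡ 0ℚ
  maxOver-none []       _    = refl
  maxOver-none (x ∷ xs) none with P x in px
  ... | true  = ⊥-elim (none x px)
  ... | false = maxOver-none xs none

maxOver-cong : ∀ {A : Set} (P : A → Bool) {f g : A → ℚ} → (∀ x → P x ≡ true → f x ≡ g x) →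
               ∀ xs → maxOver P f xs ≡ maxOver P g xs
maxOver-cong P {f} {g} f≡g = cong maxList ∘ concatMap-cong select-cong
  where
  select-cong : ∀ x → (if P x then f x ∷ [] else []) ≡ (if P x then g x ∷ [] else [])
  select-cong x with P x in px
  ... | true  = cong (_∷ []) (f≡g x px)
  ... | false = refl

count : ∀ {n} → (Fin n → Bool) → ℕ
count {zero}  f = 0
count {suc n} f = (if f zero then 1 else 0) +ℕ count (f ∘ suc)

count≤n : ∀ {n} (f : Fin n → Bool) → count f ≤ℕ n
count≤n {zero}  f = z≤n
count≤n {suc n} f with f zero
... | true  = s≤s (count≤n (f ∘ suc))
... | false = m≤n⇒m≤1+n (count≤n (f ∘ suc))

count-cong : ∀ {n} {f g : Fin n → Bool} → f ≗ g → count f ≡ count g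
count-cong {zero}  f≗g = refl
count-cong {suc n} f≗g = cong₂ _+ℕ_ (cong (if_then 1 else 0) (f≗g zero)) (count-cong (f≗g ∘ suc))

count-remove : ∀ {n} (f : Fin n → Bool) {v} → f v ≡ true → count f ≡ suc (count (λ x → f x ∧ not (x == v)))
count-remove {suc n} f {zero}  fv rewrite fv = cong suc (count-cong (λ x → sym (∧-identityʳ (f (suc x)))))
count-remove {suc n} f {suc v} fv with f zero | count-remove (f ∘ suc) {v} fv
... | true  | ih = cong suc ih
... | false | ih = ih

-- x − y = p − q, in the additive form that the ring solver checks.
≤-by-difference : ∀ {p q x y : ℚ} → p ≤ q → x + q ≡ y + p → x ≤ y
≤-by-difference {p} {q} {x} {y} p≤q x+q≡y+p = begin
  x             ≡⟨ solve 2 (λ x q → x := (x :+ q) :- q) refl x q ⟩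
  (x + q) - q   ≡⟨ cong (_- q) x+q≡y+p ⟩
  (y + p) - q   ≤⟨ +-monoˡ-≤ (- q) (+-monoʳ-≤ y p≤q) ⟩
  (y + q) - q   ≡⟨ solve 2 (λ y q → (y :+ q) :- q := y) refl y q ⟩
  y             ∎
  where open ≤-Reasoning
        open +-*-Solver

≤-slack : ∀ {x a c M : ℚ} → x ≤ M → a ≤ M → x - c ≤ (a - c) + (+ 2 / 1) * (M - a)
≤-slack {x} {a} {c} {M} x≤M a≤M = ≤-by-difference (+-mono-≤ x≤M a≤M)
  (solve 4 (λ x a c M → (x :- c) :+ (M :+ M) := ((a :- c) :+ con (+ 2 / 1) :* (M :- a)) :+ (x :+ a)) refl x a c M)
  where open +-*-Solver

≤-exchange : ∀ {a b U W X M : ℚ} → a - X ≤ W → U ≤ (b - X) + (+ 2 / 1) * (M - b) →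
             b - W ≤ (a - U) + (+ 2 / 1) * (M - a)
≤-exchange {a} {b} {U} {W} {X} {M} a-X≤W U≤ = ≤-by-difference (+-mono-≤ a-X≤W U≤)
  (solve 6 (λ a b U W X M →
       (b :- W) :+ (W :+ ((b :- X) :+ con (+ 2 / 1) :* (M :- b)))
    := ((a :- U) :+ con (+ 2 / 1) :* (M :- a)) :+ ((a :- X) :+ U)) refl a b U W X M)
  where open +-*-Solver

module _ {n : ℕ} {G : Graph n} where

  ∖-vertex : ∀ (b : Board G) {u x} → V b x ≡ true → x ≢ u → V (b ∖ u) x ≡ true
  ∖-vertex b Vx x≢u = ∧-true⁺ Vx (≢⇒not== x≢u)

  ∖-available : ∀ (b : Board G) {u x} → A b x ≡ true → x ≢ u → A (b ∖ u) x ≡ true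
  ∖-available b {u} {x} Ax x≢u = ∧-true⁺ (∨-trueˡ (adj G u x ∧ V b x) Ax) (≢⇒not== x≢u)

  ∖-neighbour : ∀ (b : Board G) {u x} → adj G u x ≡ true → V b x ≡ true → x ≢ u → A (b ∖ u) x ≡ true
  ∖-neighbour b {u} {x} ux Vx x≢u = ∧-true⁺ (∨-trueʳ (A b x) (∧-true⁺ ux Vx)) (≢⇒not== x≢u)

  legal⇒V : ∀ (b : Board G) {v} → legal b v ≡ true → V b v ≡ true
  legal⇒V b {v} lv = [ A⊆V b v , ∧-conicalˡ _ _ ]′ (∨-true⁻ lv)

  legal⇒A : ∀ (b : Board G) → NoUnbroached b → ∀ {v} → legal b v ≡ true → A b v ≡ true
  legal⇒A b nu {v} lv = trans (sym (∨-identityʳ (A b v))) (subst (λ t → A b v ∨ t ≡ true) (nu v) lv)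

  reach⇒V : ∀ (b : Board G) k {v x} → reach b k v x ≡ true → V b x ≡ true
  reach⇒V b zero {v} {x} r with refl ← ==⇒≡ {x = x} {y = v} (∧-conicalʳ _ _ r) = ∧-conicalˡ _ _ r
  reach⇒V b (suc k) r = [ reach⇒V b k , ∧-conicalˡ _ _ ]′ (∨-true⁻ r)

  -- A path from x that meets u enters it from a neighbour of u, and that neighbour is available in b ∖ u.
  reach-∖ : ∀ (b : Board G) u k {x y} → x ≢ u → reach b k x y ≡ true →
            (y ≢ u × reach (b ∖ u) k x y ≡ true) ⊎ (∃[ z ] reach (b ∖ u) k x z ≡ true × A (b ∖ u) z ≡ true)
  reach-∖ b u zero {x} {y} x≢u r with refl ← ==⇒≡ {x = y} {y = x} (∧-conicalʳ _ _ r) =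
    inj₁ (x≢u , ∧-true⁺ (∖-vertex b (∧-conicalˡ _ _ r) x≢u) (==-refl {x = x}))
  reach-∖ b u (suc k) {x} {y} x≢u r with ∨-true⁻ r
  ... | inj₁ r′ = Sum.map (map₂ (∨-trueˡ _)) (map₂ (map₁ (∨-trueˡ _))) (reach-∖ b u k x≢u r′)
  ... | inj₂ step with any-witness _ (allFin n) (∧-conicalʳ _ _ step)
  ... | z , rz∧zy with reach-∖ b u k x≢u (∧-conicalˡ _ _ rz∧zy)
  ...   | inj₂ (w , rw , Aw) = inj₂ (w , ∨-trueˡ _ rw , Aw)
  ...   | inj₁ (z≢u , rz) = case y ≟ u of λ where
    (yes refl) → inj₂ (z , ∨-trueˡ _ rz ,
                       ∖-neighbour b (trans (adj-sym G u z) (∧-conicalʳ _ _ rz∧zy))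
                                     (reach⇒V b k (∧-conicalˡ _ _ rz∧zy)) z≢u)
    (no y≢u)   → inj₁ (y≢u , ∨-trueʳ _ (∧-true⁺ (∖-vertex b (∧-conicalˡ _ _ step) y≢u)
                                (any-true _ (∈-allFin z) (∧-true⁺ rz (∧-conicalʳ _ _ rz∧zy)))))

  NoUnbroached-∖ : ∀ {b : Board G} → NoUnbroached b → ∀ u → NoUnbroached (b ∖ u)
  NoUnbroached-∖ {b} nu u x = ∧-not≡false broached
    where
    broached : V (b ∖ u) x ≡ true → any (λ y → sameComponent (b ∖ u) x y ∧ A (b ∖ u) y) (allFin n) ≡ true
    broached Vx with any-witness _ (allFin n) (∧-not≡false⁻ (∧-conicalˡ _ _ Vx) (nu x))
    ... | y , ry∧Ay with reach-∖ b u n (not==⇒≢ (∧-conicalʳ _ _ Vx)) (∧-conicalˡ _ _ ry∧Ay)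
    ...   | inj₁ (y≢u , ry) = any-true _ (∈-allFin y) (∧-true⁺ ry (∖-available b (∧-conicalʳ _ _ ry∧Ay) y≢u))
    ...   | inj₂ (z , rz , Az) = any-true _ (∈-allFin z) (∧-true⁺ rz Az)

  record _≋_ (b b′ : Board G) : Set where
    constructor _,_
    field
      V-≡ : ∀ x → V b x ≡ V b′ x
      A-≡ : ∀ x → A b x ≡ A b′ x

  reach-cong : ∀ {b b′} → b ≋ b′ → ∀ k v x → reach b k v x ≡ reach b′ k v x
  reach-cong (V≡ , _) zero    v x = cong (_∧ (x == v)) (V≡ v)
  reach-cong b≋b′@(V≡ , _) (suc k) v x =
    cong₂ _∨_ (reach-cong b≋b′ k v x)
              (cong₂ _∧_ (V≡ x) (cong or (map-cong (λ y → cong (_∧ adj G y x) (reach-cong b≋b′ k v y)) (allFin n))))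

  legal-cong : ∀ {b b′} → b ≋ b′ → ∀ v → legal b v ≡ legal b′ v
  legal-cong b≋b′@(V≡ , A≡) v =
    cong₂ _∨_ (A≡ v)
              (cong₂ _∧_ (V≡ v) (cong not (cong or (map-cong (λ x → cong₂ _∧_ (reach-cong b≋b′ n v x) (A≡ x)) (allFin n)))))

  ∖-cong : ∀ {b b′} → b ≋ b′ → ∀ v → (b ∖ v) ≋ (b′ ∖ v)
  ∖-cong (V≡ , A≡) v = (λ x → cong (_∧ not (x == v)) (V≡ x))
                     , (λ x → cong₂ (λ a s → (a ∨ adj G v x ∧ s) ∧ not (x == v)) (A≡ x) (V≡ x))

  ∖-comm : ∀ (b : Board G) u v → ((b ∖ v) ∖ u) ≋ ((b ∖ u) ∖ v)
  ∖-comm b u v = (λ x → solve 3 (λ s e f → (s :* e) :* f := (s :* f) :* e) refl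
                           (V b x) (not (x == v)) (not (x == u)))
               , (λ x → solve 6 (λ a p q s e f → ((a :+ p :* s) :* e :+ q :* (s :* e)) :* f
                                             := ((a :+ q :* s) :* f :+ p :* (s :* f)) :* e) refl
                           (A b x) (adj G v x) (adj G u x) (V b x) (not (x == v)) (not (x == u)))
    where open ∨-∧-Solver

  valF-cong : ∀ k {b b′} → b ≋ b′ → valF k b ≡ valF k b′
  valF-cong zero    _     = refl
  valF-cong (suc k) b≋b′ = cong maxList (concatMap-cong (λ v →
    cong₂ (λ l t → if l then (wt G v - t) ∷ [] else []) (legal-cong b≋b′ v) (valF-cong k (∖-cong b≋b′ v)))
    (allFin n))

  moveValue : ℕ → Board G → Fin n → ℚ
  moveValue k b v = wt G v - valF k (b ∖ v)

  moveValue≤valF : ∀ k (b : Board G) {v} → legal b v ≡ true → moveValue k b v ≤ valF (suc k) b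
  moveValue≤valF k b = maxOver-ub (legal b) (moveValue k b) (∈-allFin _)

  valF≤ : ∀ k (b : Board G) {u B} → legal b u ≡ true → (∀ v → legal b v ≡ true → moveValue k b v ≤ B) →
          valF (suc k) b ≤ B
  valF≤ k b = maxOver-lub (legal b) (moveValue k b) (∈-allFin _)

  count-∖ : ∀ (b : Board G) {v k} → V b v ≡ true → count (V b) ≤ℕ suc k → count (V (b ∖ v)) ≤ℕ k
  count-∖ b {v} {k} Vv = ≤-pred ∘ subst (_≤ℕ suc k) (count-remove (V b) Vv)

  valF-stable : ∀ k (b : Board G) → count (V b) ≤ℕ k → valF (suc k) b ≡ valF k b
  valF-stable zero    b size≤0 = maxOver-none (legal b) (moveValue 0 b) (allFin n) no-move
    where
    no-move : ∀ v → legal b v ≢ true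
    no-move v lv with () ← subst (_≤ℕ 0) (count-remove (V b) (legal⇒V b lv)) size≤0
  valF-stable (suc k) b size≤ = maxOver-cong (legal b) (λ v lv →
    cong (λ t → wt G v - t) (valF-stable k (b ∖ v) (count-∖ b (legal⇒V b lv) size≤))) (allFin n)

  WeightBound : Board G → ℚ → Set
  WeightBound b M = ∀ x → V b x ≡ true → wt G x ≤ M

  maxWt-bound : ∀ (b : Board G) → WeightBound b (maxWt b)
  maxWt-bound b x = maxOver-ub (V b) (wt G) (∈-allFin x)

  valF-bound : ∀ k (g : Board G) → NoUnbroached g → ∀ {u M} → A g u ≡ true → WeightBound g M →
               valF (suc k) g ≤ moveValue k g u + (+ 2 / 1) * (M - wt G u)
  moveValue-bound : ∀ k (g : Board G) → NoUnbroached g → ∀ {u v M} → A g u ≡ true → A g v ≡ true →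
                    WeightBound g M → moveValue k g v ≤ moveValue k g u + (+ 2 / 1) * (M - wt G u)
  moveValue-bound∖ : ∀ k (g : Board G) → NoUnbroached g → ∀ {u w M} → A g u ≡ true → A g w ≡ true → u ≢ w →
                     WeightBound (g ∖ u) M →
                     moveValue (suc k) g w ≤ moveValue (suc k) g u + (+ 2 / 1) * (M - wt G u)

  valF-bound k g nu au bound =
    valF≤ k g (∨-trueˡ _ au) (λ v lv → moveValue-bound k g nu au (legal⇒A g nu lv) bound)

  moveValue-bound k g nu {u} {v} au av bound with v ≟ u
  ... | yes refl = ≤-slack {c = valF k (g ∖ u)} (bound u (A⊆V g u au)) (bound u (A⊆V g u au))
  moveValue-bound zero    g nu {u} {v} au av bound | no v≢u =
    ≤-slack {c = 0ℚ} (bound v (A⊆V g v av)) (bound u (A⊆V g u au))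
  moveValue-bound (suc k) g nu au av bound | no v≢u =
    moveValue-bound∖ k g nu au av (v≢u ∘ sym) (λ x Vx → bound x (∧-conicalˡ _ _ Vx))

  -- Answer w by u, and compare with the position after u and then w, to which induction applies.
  moveValue-bound∖ k g nu {u} {w} {M} au aw u≢w bound =
    ≤-exchange {a = wt G u} {b = wt G w} {M = M} answer-u induction
    where
    answer-u : wt G u - valF k ((g ∖ u) ∖ w) ≤ valF (suc k) (g ∖ w)
    answer-u = subst (λ t → wt G u - t ≤ valF (suc k) (g ∖ w)) (valF-cong k (∖-comm g u w))
                 (moveValue≤valF k (g ∖ w) (∨-trueˡ _ (∖-available g au u≢w)))
    induction : valF (suc k) (g ∖ u) ≤ moveValue k (g ∖ u) w + (+ 2 / 1) * (M - wt G w)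
    induction = valF-bound k (g ∖ u) (NoUnbroached-∖ nu u) (∖-available g aw (u≢w ∘ sym)) bound

lemma1p5 : ∀ {n : ℕ} (G : Graph n) (g : Board G) → NoUnbroached g →
           (u w : Fin n) → A g u ≡ true → A g w ≡ true → u ≢ w →
           (val g ≤ (wt G u - val (g ∖ u)) + (+ 2 / 1) * (maxWt g - wt G u))
           × ((wt G w - val (g ∖ w)) ≤ (wt G u - val (g ∖ u)) + (+ 2 / 1) * (maxWtExcept g u - wt G u))
lemma1p5 {suc n} G g nu u w au aw u≢w =
    subst (λ t → val g ≤ (wt G u - t) + (+ 2 / 1) * (maxWt g - wt G u)) stable
          (valF-bound n g nu au (maxWt-bound g))
  , moveValue-bound∖ n g nu au aw u≢w (maxWt-bound (g ∖ u))
  where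
  stable : valF n (g ∖ u) ≡ val (g ∖ u)
  stable = sym (valF-stable n (g ∖ u) (count-∖ g (A⊆V g u au) (count≤n (V g))))
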